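{- Let $\Pi$ be a projective plane of order $q\geq 23$ and let $S=\mathcal{P}_S\cup\mathcal{L}_S$ be a resolving set of the incidence graph of $\Pi$ with $|S|\leq 4q-4$ and $|\mathcal{P}_S|\leq|\mathcal{L}_S|$, where $\mathcal{P}_S$ is its set of points and $\mathcal{L}_S$ its set of lines. Then every line of $\Pi$ contains either at most $4$ or at least $q-4$ points of $\mathcal{P}_S$.
   Context: The incidence graph of $\Pi$ is the bipartite graph on points and lines with adjacency given by incidence. A set of vertices is resolving if the ordered distance lists of all vertices with respect to it are pairwise distinct. -}

module Defs where

open import Data.Nat using (ℕ; zero; suc; _+_; _*_; _≤_)
open import Data.Fin using (Fin)
open import Data.Fin.Subset using (Subset; _∈_; ∣_∣)
open import Data.Bool using (Bool; true; false; _∧_; _∨_; if_then_else_)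
open import Data.Sum using (_⊎_; inj₁; inj₂)
open import Data.Product using (_×_; Σ; ∃; ∃-syntax; _,_)
open import Data.List using (List; allFin; filter; length)
open import Data.Bool.ListAction using (any)
open import Relation.Binary.PropositionalEquality using (_≡_; _≢_)
open import Relation.Nullary using (¬_)
open import Relation.Nullary.Decidable using (⌊_⌋; _×-dec_)
open import Data.Fin using (_≟_)
open import Data.Fin.Subset.Properties using (_∈?_)
import Data.Bool as B
open import Data.List using (_++_; map)

numPts : ℕ → ℕ
numPts q = q * q + q + 1

record ProjectivePlane (q : ℕ) : Set where
  field
    inc : Fin (numPts q) → Fin (numPts q) → Bool
    line-through : ∀ p p′ → p ≢ p′ →
      ∃[ ℓ ] (inc p ℓ ≡ true × inc p′ ℓ ≡ true ×
              (∀ m → inc p m ≡ true → inc p′ m ≡ true → m ≡ ℓ))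
    meet : ∀ ℓ ℓ′ → ℓ ≢ ℓ′ →
      ∃[ p ] (inc p ℓ ≡ true × inc p ℓ′ ≡ true ×
              (∀ r → inc r ℓ ≡ true → inc r ℓ′ ≡ true → r ≡ p))
    quadrangle : Σ (Fin 4 → Fin (numPts q)) λ f →
      (∀ i j → i ≢ j → f i ≢ f j) ×
      (∀ i j k → i ≢ j → j ≢ k → i ≢ k → ∀ ℓ →
         ¬ (inc (f i) ℓ ≡ true × inc (f j) ℓ ≡ true × inc (f k) ℓ ≡ true))
    line-size : ∀ ℓ → length (filter (λ p → inc p ℓ B.≟ true) (allFin (numPts q))) ≡ suc q

open ProjectivePlane public

module _ {q : ℕ} (Π : ProjectivePlane q) where

  N : ℕ
  N = numPts q

  -- vertices of the incidence graph: points (inj₁) and lines (inj₂)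
  Vertex : Set
  Vertex = Fin N ⊎ Fin N

  adj : Vertex → Vertex → Bool
  adj (inj₁ p) (inj₂ ℓ) = inc Π p ℓ
  adj (inj₂ ℓ) (inj₁ p) = inc Π p ℓ
  adj (inj₁ _) (inj₁ _) = false
  adj (inj₂ _) (inj₂ _) = false

  allVertices : List Vertex
  allVertices = map inj₁ (allFin N) ++ map inj₂ (allFin N)

  eqV : Vertex → Vertex → Bool
  eqV (inj₁ a) (inj₁ b) = ⌊ a ≟ b ⌋
  eqV (inj₂ a) (inj₂ b) = ⌊ a ≟ b ⌋
  eqV _ _ = false

  walk : ℕ → Vertex → Vertex → Bool
  walk zero u v = eqV u v
  walk (suc k) u v = any (λ w → adj u w ∧ walk k w v) allVertices

  distFrom : ℕ → ℕ → Vertex → Vertex → ℕ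
  distFrom i zero u v = i
  distFrom i (suc fuel) u v = if walk i u v then i else distFrom (suc i) fuel u v

  -- graph distance in the incidence graph (the graph is connected with
  -- 2N vertices, so the least walk length is < 2N and the search finds it)
  dist : Vertex → Vertex → ℕ
  dist u v = distFrom 0 (N + N) u v

  inS : Subset N → Subset N → Vertex → Set
  inS PS LS (inj₁ p) = p ∈ PS
  inS PS LS (inj₂ ℓ) = ℓ ∈ LS

  Resolving : Subset N → Subset N → Set
  Resolving PS LS = ∀ u v → (∀ s → inS PS LS s → dist u s ≡ dist v s) → u ≡ v

  pointsOn : Subset N → Fin N → ℕ
  pointsOn PS ℓ = length (filter (λ p → (inc Π p ℓ B.≟ true) ×-dec (p ∈? PS)) (allFin N))

-- Suppose a line ℓ carries k points of PS with 5 ≤ k ≤ q − 5, and let a = |PS ∖ ℓ|. Each of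
-- the q + 1 − k points R of ℓ outside PS lies on at least q lines other than ℓ, and these
-- lines share at most a points of PS. Charging every line m the deficit 2 if m ∈ LS and
-- max(0, 2 − |m ∩ PS|) otherwise, the lines through R thus have total deficit at least
-- 2q − a, and summing over R (a line other than ℓ meets ℓ once) the lines meeting ℓ outside
-- PS have total deficit at least (2q − a)(q + 1 − k). Since S resolves the incidence graph
-- and a line has distance 1 or 3 to a point and 2 to any other line, two lines outside LS
-- with the same points of PS coincide: so at most one line outside LS misses PS, and the
-- lines outside LS meeting PS in a single point (necessarily off ℓ) inject into PS ∖ ℓ.
-- The total deficit is therefore at most 2|LS| + 2 + a, which together with
-- k + a = |PS| ≤ |LS| and |PS| + |LS| ≤ 4q − 4 is impossible once q ≥ 23.

module Submission where

open import Defs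
open import Data.Nat using (ℕ; zero; suc; _+_; _*_; _∸_; _≤_; _<_; z≤n; s≤s; _≤?_)
import Data.Nat as ℕ
open import Data.Nat.Properties hiding (_≟_)
open import Data.Nat.Tactic.RingSolver using (solve-∀)
open import Algebra.Properties.Semiring.Sum +-*-semiring
  using (sum; sum-syntax; ∑-comm; ∑-distrib-+; sum-cong-≗; sum-replicate-zero; *-distribˡ-sum)
open import Data.Bool using (Bool; true; false; if_then_else_; not; _∧_)
import Data.Bool as Bool
open import Data.Bool.ListAction using (any)
open import Data.Bool.Properties using (¬-not)
open import Data.Empty using (⊥; ⊥-elim)
open import Data.Fin using (Fin; zero; suc; _≟_)
import Data.Fin.Properties as Fin
open import Data.Fin.Patterns using (0F; 1F; 2F)
open import Data.Fin.Subset using (Subset; ∣_∣; inside; outside; _∈_; _∉_)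
open import Data.Fin.Subset.Properties using (_∈?_)
open import Data.List using (List; []; _∷_; map; length; filter; tabulate; allFin)
open import Data.List.Membership.Propositional using () renaming (_∈_ to _∈ᴸ_)
open import Data.List.Membership.Propositional.Properties using (∈-allFin; ∈-map⁺; ∈-++⁺ˡ; ∈-++⁺ʳ)
open import Data.List.Relation.Unary.Any using (here; there)
open import Data.Product using (_×_; _,_; ∃; proj₁; proj₂; swap)
open import Data.Sum using (_⊎_; inj₁; inj₂)
open import Data.Sum.Properties using (inj₂-injective)
open import Data.Vec using ([]; _∷_)
open import Function using (_∘_)
open import Level using (Level)
open import Relation.Binary.PropositionalEquality
open import Relation.Nullary using (Dec; does; yes; no; ¬_; ¬?; contradiction; _×-dec_)
open import Relation.Nullary.Decidable using (⌊_⌋; isYes≗does; dec-true)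
open import Relation.Unary using (Pred; Decidable; _≐_)
open import Relation.Unary.Properties using (_∩?_; ∁?)

private
  variable
    a b c : Level
    m n : ℕ

sum-mono-≤ : {f g : Fin n → ℕ} → (∀ i → f i ≤ g i) → sum f ≤ sum g
sum-mono-≤ {zero}  f≤g = z≤n
sum-mono-≤ {suc n} f≤g = +-mono-≤ (f≤g zero) (sum-mono-≤ (f≤g ∘ suc))

sum-zero : {f : Fin n → ℕ} → (∀ i → f i ≡ 0) → sum f ≡ 0
sum-zero {n} f≡0 = trans (sum-cong-≗ f≡0) (sum-replicate-zero n)

term≤sum : (f : Fin n → ℕ) (i : Fin n) → f i ≤ sum f
term≤sum f zero    = m≤m+n (f zero) _
term≤sum f (suc i) = ≤-trans (term≤sum (f ∘ suc) i) (m≤n+m _ (f zero))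

sum≤-single-support : {f : Fin n → ℕ} {c : ℕ} → (∀ i → f i ≤ c) →
  (∀ i j → f i ≢ 0 → f j ≢ 0 → i ≡ j) → sum f ≤ c
sum≤-single-support {zero}  _ _ = z≤n
sum≤-single-support {suc n} {f} f≤c single with f zero ℕ.≟ 0
... | yes f₀≡0 = subst (λ x → x + sum (f ∘ suc) ≤ _) (sym f₀≡0)
  (sum≤-single-support (f≤c ∘ suc) (λ i j fi fj → Fin.suc-injective (single (suc i) (suc j) fi fj)))
... | no  f₀≢0 = subst (λ x → f zero + x ≤ _) (sym (sum-zero tail≡0))
  (subst (_≤ _) (sym (+-identityʳ (f zero))) (f≤c zero))
  where
  tail≡0 : ∀ i → f (suc i) ≡ 0
  tail≡0 i with f (suc i) ℕ.≟ 0
  ... | yes fi≡0 = fi≡0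
  ... | no  fi≢0 = contradiction (single zero (suc i) f₀≢0 fi≢0) λ ()

sumOn : {P : Pred (Fin n) a} → Decidable P → (Fin n → ℕ) → ℕ
sumOn {n} P? f = ∑[ i < n ] (if does (P? i) then f i else 0)

count : {P : Pred (Fin n) a} → Decidable P → ℕ
count P? = sumOn P? (λ _ → 1)

module _ {n : ℕ} {P : Pred (Fin n) a} (P? : Decidable P) where

  sumOn-mono : {f g : Fin n → ℕ} → (∀ {i} → P i → f i ≤ g i) → sumOn P? f ≤ sumOn P? g
  sumOn-mono f≤g = sum-mono-≤ pointwise
    where
    pointwise : ∀ i → (if does (P? i) then _ else 0) ≤ (if does (P? i) then _ else 0)
    pointwise i with P? i
    ... | yes Pi = f≤g Pi
    ... | no  _  = z≤n

  sumOn-+ : (f g : Fin n → ℕ) → sumOn P? (λ i → f i + g i) ≡ sumOn P? f + sumOn P? g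
  sumOn-+ f g = trans (sum-cong-≗ pointwise) (∑-distrib-+ {n} _ _)
    where
    pointwise : ∀ i → (if does (P? i) then f i + g i else 0) ≡
                      (if does (P? i) then f i else 0) + (if does (P? i) then g i else 0)
    pointwise i with does (P? i)
    ... | true  = refl
    ... | false = refl

  sumOn-const : (c : ℕ) → sumOn P? (λ _ → c) ≡ c * count P?
  sumOn-const c = trans (sum-cong-≗ pointwise) (sym (*-distribˡ-sum {n} c _))
    where
    pointwise : ∀ i → (if does (P? i) then c else 0) ≡ c * (if does (P? i) then 1 else 0)
    pointwise i with does (P? i)
    ... | true  = sym (*-identityʳ c)
    ... | false = sym (*-zeroʳ c)

  sumOn-empty : (f : Fin n → ℕ) → (∀ i → ¬ P i) → sumOn P? f ≡ 0
  sumOn-empty f ¬P = sum-zero pointwise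
    where
    pointwise : ∀ i → (if does (P? i) then f i else 0) ≡ 0
    pointwise i with P? i
    ... | yes Pi = contradiction Pi (¬P i)
    ... | no  _  = refl

  term≤sumOn : (f : Fin n → ℕ) {i : Fin n} → P i → f i ≤ sumOn P? f
  term≤sumOn f {i} Pi = ≤-trans (≤-reflexive (sym if-Pi)) (term≤sum _ i)
    where
    if-Pi : (if does (P? i) then f i else 0) ≡ f i
    if-Pi with P? i
    ... | yes _   = refl
    ... | no  ¬Pi = contradiction Pi ¬Pi

  sumOn-split : {Q : Pred (Fin n) b} (Q? : Decidable Q) (f : Fin n → ℕ) →
    sumOn P? f ≡ sumOn (P? ∩? Q?) f + sumOn (P? ∩? ∁? Q?) f
  sumOn-split Q? f = trans (sum-cong-≗ pointwise) (∑-distrib-+ {n} _ _)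
    where
    pointwise : ∀ i → (if does (P? i) then f i else 0) ≡
      (if does ((P? ∩? Q?) i) then f i else 0) + (if does ((P? ∩? ∁? Q?) i) then f i else 0)
    pointwise i with P? i | Q? i
    ... | yes _ | yes _ = sym (+-identityʳ (f i))
    ... | yes _ | no  _ = refl
    ... | no  _ | yes _ = refl
    ... | no  _ | no  _ = refl

  sumOn-≗ : {f g : Fin n → ℕ} → (∀ i → f i ≡ g i) → sumOn P? f ≡ sumOn P? g
  sumOn-≗ f≗g = sum-cong-≗ λ i → cong (λ x → if does (P? i) then x else 0) (f≗g i)

  sumOn-≐ : {Q : Pred (Fin n) b} (Q? : Decidable Q) (f : Fin n → ℕ) →
    P ≐ Q → sumOn P? f ≡ sumOn Q? f
  sumOn-≐ Q? f (P⊆Q , Q⊆P) = sum-cong-≗ pointwise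
    where
    pointwise : ∀ i → (if does (P? i) then f i else 0) ≡ (if does (Q? i) then f i else 0)
    pointwise i with P? i | Q? i
    ... | yes _  | yes _  = refl
    ... | yes Pi | no ¬Qi = contradiction (P⊆Q Pi) ¬Qi
    ... | no ¬Pi | yes Qi = contradiction (Q⊆P Qi) ¬Pi
    ... | no  _  | no  _  = refl

module _ {m n : ℕ} {P : Pred (Fin m) a} (P? : Decidable P)
         {R : Fin m → Fin n → Set b} (R? : ∀ i → Decidable (R i))
         {Q : Pred (Fin n) c} (Q? : Decidable Q) (f : Fin n → ℕ) where

  private
    g : Fin m → Fin n → ℕ
    g i j = if does (P? i) then (if does (R? i j) then f j else 0) else 0

    row : ∀ i → (if does (P? i) then sumOn (R? i) f else 0) ≡ ∑[ j < n ] g i j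
    row i with does (P? i)
    ... | true  = refl
    ... | false = sym (sum-zero {n} λ _ → refl)

    support : ∀ {i j} → g i j ≢ 0 → P i × R i j
    support {i} {j} gij≢0 with P? i | R? i j
    ... | yes Pi | yes Rij = Pi , Rij
    ... | yes _  | no  _   = contradiction refl gij≢0
    ... | no  _  | _       = contradiction refl gij≢0

  double-counting : (∀ {i j} → P i → R i j → Q j) →
    (∀ {i i′ j} → P i → P i′ → R i j → R i′ j → i ≡ i′) →
    sumOn P? (λ i → sumOn (R? i) f) ≤ sumOn Q? f
  double-counting R⇒Q unique = begin
    sumOn P? (λ i → sumOn (R? i) f) ≡⟨ sum-cong-≗ row ⟩
    ∑[ i < m ] ∑[ j < n ] g i j     ≡⟨ ∑-comm g ⟩
    ∑[ j < n ] ∑[ i < m ] g i j     ≤⟨ sum-mono-≤ column ⟩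
    sumOn Q? f                      ∎
    where
    open ≤-Reasoning
    bound : ∀ i j → g i j ≤ (if does (Q? j) then f j else 0)
    bound i j with P? i | R? i j | Q? j
    ... | yes _  | yes _   | yes _   = ≤-refl
    ... | yes Pi | yes Rij | no  ¬Qj = contradiction (R⇒Q Pi Rij) ¬Qj
    ... | yes _  | no  _   | _       = z≤n
    ... | no  _  | _       | _       = z≤n
    column : ∀ j → ∑[ i < m ] g i j ≤ (if does (Q? j) then f j else 0)
    column j = sum≤-single-support (λ i → bound i j) λ i i′ gij≢0 gi′j≢0 →
      let Pi , Rij = support gij≢0 ; Pi′ , Ri′j = support gi′j≢0 in unique Pi Pi′ Rij Ri′j

count≤1 : {P : Pred (Fin n) a} (P? : Decidable P) → (∀ {i j} → P i → P j → i ≡ j) → count P? ≤ 1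
count≤1 {P = P} P? unique =
  sum≤-single-support bound λ i j i≢0 j≢0 → unique (support i i≢0) (support j j≢0)
  where
  bound : ∀ i → (if does (P? i) then 1 else 0) ≤ 1
  bound i with does (P? i)
  ... | true  = ≤-refl
  ... | false = z≤n
  support : ∀ i → (if does (P? i) then 1 else 0) ≢ 0 → P i
  support i ≢0 with P? i
  ... | yes Pi = Pi
  ... | no  _  = contradiction refl ≢0

1≤count : {P : Pred (Fin n) a} (P? : Decidable P) → ∀ {i} → P i → 1 ≤ count P?
1≤count P? = term≤sumOn P? (λ _ → 1)

count-witness : {P : Pred (Fin n) a} (P? : Decidable P) → 1 ≤ count P? → ∃ P
count-witness P? 1≤count with Fin.any? P?
... | yes ∃P = ∃P
... | no  ∄P = contradiction (subst (1 ≤_) (sumOn-empty P? _ λ i Pi → ∄P (i , Pi)) 1≤count) λ ()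

count≤1⇒unique : {P : Pred (Fin n) a} (P? : Decidable P) → count P? ≤ 1 → ∀ {i j} → P i → P j → i ≡ j
count≤1⇒unique P? count≤1 {i} {j} Pi Pj with j Fin.≟ i
... | yes j≡i = sym j≡i
... | no  j≢i = contradiction (≤-trans 2≤count count≤1) λ { (s≤s ()) }
  where
  2≤count : 2 ≤ count P?
  2≤count = subst (2 ≤_) (sym (sumOn-split P? (Fin._≟ i) _))
    (+-mono-≤ (1≤count (P? ∩? (Fin._≟ i)) (Pi , refl))
              (1≤count (P? ∩? ∁? (Fin._≟ i)) (Pj , j≢i)))

count-≤-injective : {P : Pred (Fin m) a} (P? : Decidable P)
  {R : Fin m → Fin n → Set b} (R? : ∀ i → Decidable (R i)) {Q : Pred (Fin n) c} (Q? : Decidable Q) →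
  (∀ {i} → P i → ∃ (R i)) → (∀ {i j} → P i → R i j → Q j) →
  (∀ {i i′ j} → P i → P i′ → R i j → R i′ j → i ≡ i′) → count P? ≤ count Q?
count-≤-injective P? R? Q? total R⇒Q unique = ≤-trans
  (sumOn-mono P? λ Pi → let _ , Rij = total Pi in 1≤count (R? _) Rij)
  (double-counting P? R? Q? (λ _ → 1) R⇒Q unique)

length-filter-tabulate : {A : Set b} {P : Pred A a} (P? : Decidable P) (f : Fin n → A) →
  length (filter P? (tabulate f)) ≡ count (P? ∘ f)
length-filter-tabulate {n = zero}  P? f = refl
length-filter-tabulate {n = suc n} P? f with does (P? (f zero))
... | true  = cong suc (length-filter-tabulate P? (f ∘ suc))
... | false = length-filter-tabulate P? (f ∘ suc)

length-filter-allFin : {P : Pred (Fin n) a} (P? : Decidable P) → length (filter P? (allFin n)) ≡ count P?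
length-filter-allFin P? = length-filter-tabulate P? (λ i → i)

∣p∣≡count : (p : Subset n) → ∣ p ∣ ≡ count (_∈? p)
∣p∣≡count []            = refl
∣p∣≡count (inside  ∷ p) = cong suc (∣p∣≡count p)
∣p∣≡count (outside ∷ p) = ∣p∣≡count p

any-true⁺ : {A : Set} (f : A → Bool) {x : A} {xs : List A} → x ∈ᴸ xs → f x ≡ true → any f xs ≡ true
any-true⁺ f (here refl) fx rewrite fx = refl
any-true⁺ f {xs = y ∷ _} (there x∈xs) fx with f y
... | true  = refl
... | false = any-true⁺ f x∈xs fx

any-true⁻ : {A : Set} (f : A → Bool) (xs : List A) → any f xs ≡ true → ∃ λ x → f x ≡ true
any-true⁻ f (x ∷ xs) any≡true with f x in fx
... | true  = x , fx
... | false = any-true⁻ f xs any≡true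

∧-true⁻ : ∀ {a b} → (a ∧ b) ≡ true → a ≡ true × b ≡ true
∧-true⁻ {true} {true} _ = refl , refl

bool-ext : ∀ {a b : Bool} → (a ≡ true → b ≡ true) → (b ≡ true → a ≡ true) → a ≡ b
bool-ext {false} {false} _ _ = refl
bool-ext {false} {true}  _ b⇒a = b⇒a refl
bool-ext {true}  {false} a⇒b _ = sym (a⇒b refl)
bool-ext {true}  {true}  _ _ = refl

⌊≟⌋-refl : ∀ {n} (i : Fin n) → ⌊ i ≟ i ⌋ ≡ true
⌊≟⌋-refl i = trans (isYes≗does (i ≟ i)) (dec-true (i ≟ i) refl)

⌊≟⌋⇒≡ : ∀ {n} {i j : Fin n} → ⌊ i ≟ j ⌋ ≡ true → i ≡ j
⌊≟⌋⇒≡ {i = i} {j} eq with i ≟ j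
... | yes i≡j = i≡j

module _ {q : ℕ} (Π : ProjectivePlane q) where

  Incident : Fin (numPts q) → Fin (numPts q) → Set
  Incident p m = inc Π p m ≡ true

  incident? : ∀ p m → Dec (Incident p m)
  incident? p m = inc Π p m Bool.≟ true

  count-points-on : ∀ m → count (λ p → incident? p m) ≡ suc q
  count-points-on m = trans (sym (length-filter-allFin (λ p → incident? p m))) (line-size Π m)

  point-on : ∀ m → ∃ λ p → Incident p m
  point-on m = count-witness (λ p → incident? p m) (subst (1 ≤_) (sym (count-points-on m)) (s≤s z≤n))

  lines-meet-once : ∀ {m m′ x y} → m ≢ m′ →
    Incident x m → Incident x m′ → Incident y m → Incident y m′ → x ≡ y
  lines-meet-once {m} {m′} m≢m′ x∈m x∈m′ y∈m y∈m′ =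
    let _ , _ , _ , unique = meet Π m m′ m≢m′
    in trans (unique _ x∈m x∈m′) (sym (unique _ y∈m y∈m′))

  points-join-once : ∀ {x y m m′} → x ≢ y →
    Incident x m → Incident y m → Incident x m′ → Incident y m′ → m ≡ m′
  points-join-once {x} {y} x≢y x∈m y∈m x∈m′ y∈m′ =
    let _ , _ , _ , unique = line-through Π x y x≢y
    in trans (unique _ x∈m y∈m) (sym (unique _ x∈m′ y∈m′))

  line-avoiding : ∀ R → ∃ λ n → ¬ Incident R n
  line-avoiding R with quadrangle Π
  ... | f , distinct , noncollinear
    with line-through Π (f 0F) (f 1F) (distinct 0F 1F λ ())
       | line-through Π (f 0F) (f 2F) (distinct 0F 2F λ ())
       | line-through Π (f 1F) (f 2F) (distinct 1F 2F λ ())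
  ... | L₀₁ , f₀∈L₀₁ , f₁∈L₀₁ , _ | L₀₂ , f₀∈L₀₂ , f₂∈L₀₂ , _ | L₁₂ , f₁∈L₁₂ , f₂∈L₁₂ , _
    with incident? R L₀₁ | incident? R L₀₂
  ... | no  R∉L₀₁ | _         = L₀₁ , R∉L₀₁
  ... | yes _     | no  R∉L₀₂ = L₀₂ , R∉L₀₂
  ... | yes R∈L₀₁ | yes R∈L₀₂ =
    L₁₂ , λ R∈L₁₂ → collinear (subst (λ x → Incident x L₁₂) R≡f₀ R∈L₁₂) f₁∈L₁₂ f₂∈L₁₂
    where
    collinear : ∀ {m} → Incident (f 0F) m → Incident (f 1F) m → Incident (f 2F) m → ⊥
    collinear f₀∈m f₁∈m f₂∈m = noncollinear 0F 1F 2F (λ ()) (λ ()) (λ ()) _ (f₀∈m , f₁∈m , f₂∈m)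
    L₀₁≢L₀₂ : L₀₁ ≢ L₀₂
    L₀₁≢L₀₂ refl = collinear f₀∈L₀₁ f₁∈L₀₁ f₂∈L₀₂
    R≡f₀ : R ≡ f 0F
    R≡f₀ = lines-meet-once L₀₁≢L₀₂ R∈L₀₁ R∈L₀₂ f₀∈L₀₁ f₀∈L₀₂

  lines-through-point : ∀ {R n} → ¬ Incident R n → suc q ≤ count (λ m → incident? R m)
  lines-through-point {R} {n} R∉n = subst (_≤ _) (count-points-on n)
    (count-≤-injective (λ x → incident? x n) (λ x m → incident? x m ×-dec incident? R m)
      (λ m → incident? R m) join (λ _ (_ , R∈m) → R∈m)
      λ x∈n x′∈n (x∈m , R∈m) (x′∈m , _) →
        lines-meet-once (λ { refl → R∉n R∈m }) x∈m x∈n x′∈m x′∈n)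
    where
    join : ∀ {x} → Incident x n → ∃ λ m → Incident x m × Incident R m
    join {x} x∈n with x ≟ R
    ... | yes refl = contradiction x∈n R∉n
    ... | no  x≢R  = let m , x∈m , R∈m , _ = line-through Π x R x≢R in m , x∈m , R∈m

  other-lines-through : ∀ R ℓ → q ≤ count (λ m → incident? R m ×-dec ¬? (m ≟ ℓ))
  other-lines-through R ℓ = +-cancelˡ-≤ 1 _ _ (begin
    suc q                                                  ≤⟨ lines-through-point (proj₂ (line-avoiding R)) ⟩
    count (λ m → incident? R m)                           ≡⟨ sumOn-split (λ m → incident? R m) (_≟ ℓ) _ ⟩
    count (λ m → incident? R m ×-dec m ≟ ℓ) + count other  ≤⟨ +-monoˡ-≤ (count other) at-most-ℓ ⟩
    1 + count other                                        ∎)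
    where
    open ≤-Reasoning
    other : ∀ m → Dec (Incident R m × m ≢ ℓ)
    other m = incident? R m ×-dec ¬? (m ≟ ℓ)
    at-most-ℓ : count (λ m → incident? R m ×-dec m ≟ ℓ) ≤ 1
    at-most-ℓ = count≤1 (λ m → incident? R m ×-dec m ≟ ℓ) λ (_ , m≡ℓ) (_ , m′≡ℓ) → trans m≡ℓ (sym m′≡ℓ)

  four≤numPts : 4 ≤ numPts q
  four≤numPts = Fin.injective⇒≤ injective
    where
    f : Fin 4 → Fin (numPts q)
    f = proj₁ (quadrangle Π)
    injective : ∀ {i j} → f i ≡ f j → i ≡ j
    injective {i} {j} fi≡fj with i ≟ j
    ... | yes i≡j = i≡j
    ... | no  i≢j = contradiction fi≡fj (proj₁ (proj₂ (quadrangle Π)) i j i≢j)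

  ∈-allVertices : ∀ u → u ∈ᴸ allVertices Π
  ∈-allVertices (inj₁ p) = ∈-++⁺ˡ (∈-map⁺ inj₁ (∈-allFin p))
  ∈-allVertices (inj₂ m) = ∈-++⁺ʳ (map inj₁ (allFin (numPts q))) (∈-map⁺ inj₂ (∈-allFin m))

  walk-suc⁺ : ∀ k u w v → adj Π u w ≡ true → walk Π k w v ≡ true → walk Π (suc k) u v ≡ true
  walk-suc⁺ k u w v uw wv = any-true⁺ _ (∈-allVertices w) (cong₂ _∧_ uw wv)

  walk-suc⁻ : ∀ k u v → walk Π (suc k) u v ≡ true → ∃ λ w → adj Π u w ≡ true × walk Π k w v ≡ true
  walk-suc⁻ k u v walk≡true = let w , uwv = any-true⁻ _ (allVertices Π) walk≡true in w , ∧-true⁻ uwv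

  walk-zero⁺ : ∀ u → walk Π 0 u u ≡ true
  walk-zero⁺ (inj₁ p) = ⌊≟⌋-refl p
  walk-zero⁺ (inj₂ m) = ⌊≟⌋-refl m

  walk-zero⁻ : ∀ u v → walk Π 0 u v ≡ true → u ≡ v
  walk-zero⁻ (inj₁ p) (inj₁ p′) eq = cong inj₁ (⌊≟⌋⇒≡ eq)
  walk-zero⁻ (inj₂ m) (inj₂ m′) eq = cong inj₂ (⌊≟⌋⇒≡ eq)

  walk-one : ∀ u v → walk Π 1 u v ≡ adj Π u v
  walk-one u v = bool-ext sound (λ uv → walk-suc⁺ 0 u v v uv (walk-zero⁺ v))
    where
    sound : walk Π 1 u v ≡ true → adj Π u v ≡ true
    sound walk≡true with walk-suc⁻ 0 u v walk≡true
    ... | w , uw , wv rewrite walk-zero⁻ w v wv = uw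

  walk-line-point-two : ∀ m p → walk Π 2 (inj₂ m) (inj₁ p) ≡ false
  walk-line-point-two m p = ¬-not λ walk≡true → impossible (walk-suc⁻ 1 (inj₂ m) (inj₁ p) walk≡true)
    where
    impossible : ¬ ∃ λ w → adj Π (inj₂ m) w ≡ true × walk Π 1 w (inj₁ p) ≡ true
    impossible (inj₁ x , _ , xp) with () ← trans (sym (walk-one (inj₁ x) (inj₁ p))) xp

  walk-line-line-two : ∀ {m m′} → m ≢ m′ → walk Π 2 (inj₂ m) (inj₂ m′) ≡ true
  walk-line-line-two {m} {m′} m≢m′ =
    let x , x∈m , x∈m′ , _ = meet Π m m′ m≢m′
    in walk-suc⁺ 1 (inj₂ m) (inj₁ x) (inj₂ m′) x∈m (trans (walk-one (inj₁ x) (inj₂ m′)) x∈m′)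

  walk-three⁺ : ∀ {m x n p} → Incident x m → Incident x n → Incident p n → walk Π 3 (inj₂ m) (inj₁ p) ≡ true
  walk-three⁺ {m} {x} {n} {p} x∈m x∈n p∈n = walk-suc⁺ 2 (inj₂ m) (inj₁ x) (inj₁ p) x∈m
    (walk-suc⁺ 1 (inj₁ x) (inj₂ n) (inj₁ p) x∈n (trans (walk-one (inj₂ n) (inj₁ p)) p∈n))

  walk-line-point-three : ∀ m p → walk Π 3 (inj₂ m) (inj₁ p) ≡ true
  walk-line-point-three m p with point-on m
  ... | x , x∈m with x ≟ p
  ...   | yes refl = walk-three⁺ x∈m x∈m x∈m
  ...   | no  x≢p  = let _ , x∈n , p∈n , _ = line-through Π x p x≢p in walk-three⁺ x∈m x∈n p∈n

  -- The distance search has fuel 2N ≥ 8, enough to reach distance 3.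
  private
    dist-unfold : ∀ u v → dist Π u v ≡ distFrom Π 0 (4 + (numPts q + numPts q ∸ 4)) u v
    dist-unfold u v = cong (λ fuel → distFrom Π 0 fuel u v)
      (sym (m+[n∸m]≡n (≤-trans four≤numPts (m≤m+n (numPts q) (numPts q)))))

  dist-line-point : ∀ m p → dist Π (inj₂ m) (inj₁ p) ≡ (if inc Π p m then 1 else 3)
  dist-line-point m p rewrite dist-unfold (inj₂ m) (inj₁ p) | walk-one (inj₂ m) (inj₁ p) with inc Π p m
  ... | true  = refl
  ... | false rewrite walk-line-point-two m p | walk-line-point-three m p = refl

  dist-line-line : ∀ {m m′} → m ≢ m′ → dist Π (inj₂ m) (inj₂ m′) ≡ 2
  dist-line-line {m} {m′} m≢m′
    rewrite dist-unfold (inj₂ m) (inj₂ m′) | walk-one (inj₂ m) (inj₂ m′) | walk-line-line-two m≢m′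
    with m ≟ m′
  ... | yes m≡m′ = contradiction m≡m′ m≢m′
  ... | no  _    = refl

private
  -- The bounds in the variables q = 10 + u + v, k = 5 + v and g = 6 + u. As 2(k + a) ≤ k + a + L ≤ 4q − 4
  -- gives a ≤ 13 + 2u + v, the main bound collapses to uv + u + v ≤ 9, against u + v ≥ 13.
  shifted : ∀ u v a L → 13 ≤ u + v → 5 + v + a ≤ L → 5 + v + a + L + 4 ≤ 4 * (10 + u + v) →
    2 * (10 + u + v) * (6 + u) ≤ a * (6 + u) + (2 * L + 2 + a) → ⊥
  shifted u v a L 13≤u+v k+a≤L total≤ main≤ = ≤⇒≤ᵇ (+-cancelˡ-≤ X 13 9 (begin
    X + 13                                 ≤⟨ +-monoʳ-≤ X (≤-trans 13≤u+v (m≤n+m (u + v) (u * v))) ⟩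
    X + (u * v + (u + v))                  ≡⟨ expand u v ⟩
    2 * Q * (6 + u) + 2 * (5 + v) + 6 + 9  ≤⟨ +-monoˡ-≤ 9 key ⟩
    a * (5 + u) + 8 * Q + 9                ≤⟨ +-monoˡ-≤ 9 (+-monoˡ-≤ (8 * Q) (*-monoˡ-≤ (5 + u) a≤)) ⟩
    X + 9                                  ∎))
    where
    open ≤-Reasoning
    Q X : ℕ
    Q = 10 + u + v
    X = (13 + 2 * u + v) * (5 + u) + 8 * Q
    expand : ∀ u v → (13 + 2 * u + v) * (5 + u) + 8 * (10 + u + v) + (u * v + (u + v))
                   ≡ 2 * (10 + u + v) * (6 + u) + 2 * (5 + v) + 6 + 9
    expand = solve-∀
    a≤ : a ≤ 13 + 2 * u + v
    a≤ = +-cancelʳ-≤ (7 + v) a (13 + 2 * u + v) (*-cancelˡ-≤ 2 (begin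
      2 * (a + (7 + v))                  ≡⟨ double u v a ⟩
      (5 + v + a) + (5 + v + a) + 4      ≤⟨ +-monoˡ-≤ 4 (+-monoʳ-≤ (5 + v + a) k+a≤L) ⟩
      5 + v + a + L + 4                  ≤⟨ total≤ ⟩
      4 * Q                              ≡⟨ quadruple u v ⟩
      2 * (13 + 2 * u + v + (7 + v))     ∎))
      where
      double : ∀ u v a → 2 * (a + (7 + v)) ≡ (5 + v + a) + (5 + v + a) + 4
      double = solve-∀
      quadruple : ∀ u v → 4 * (10 + u + v) ≡ 2 * (13 + 2 * u + v + (7 + v))
      quadruple = solve-∀
    key : 2 * Q * (6 + u) + 2 * (5 + v) + 6 ≤ a * (5 + u) + 8 * Q
    key = +-cancelʳ-≤ (2 * L + 2 + a + a) _ _ (begin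
      2 * Q * (6 + u) + 2 * (5 + v) + 6 + (2 * L + 2 + a + a)      ≡⟨ lhs u v a L ⟩
      2 * Q * (6 + u) + 2 * (5 + v + a + L + 4)                    ≤⟨ +-mono-≤ main≤ (*-monoʳ-≤ 2 total≤) ⟩
      a * (6 + u) + (2 * L + 2 + a) + 2 * (4 * Q)                  ≡⟨ rhs u v a L ⟩
      a * (5 + u) + 8 * Q + (2 * L + 2 + a + a)                    ∎)
      where
      lhs : ∀ u v a L → 2 * (10 + u + v) * (6 + u) + 2 * (5 + v) + 6 + (2 * L + 2 + a + a)
                      ≡ 2 * (10 + u + v) * (6 + u) + 2 * (5 + v + a + L + 4)
      lhs = solve-∀
      rhs : ∀ u v a L → a * (6 + u) + (2 * L + 2 + a) + 2 * (4 * (10 + u + v))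
                      ≡ a * (5 + u) + 8 * (10 + u + v) + (2 * L + 2 + a + a)
      rhs = solve-∀

  6≤gap : ∀ {q k g} → 4 ≤ q → k < q ∸ 4 → g + k ≡ suc q → 6 ≤ g
  6≤gap {q} {k} {g} 4≤q k<q∸4 g+k≡1+q = +-cancelʳ-≤ k 6 g (begin
    6 + k             ≡⟨ cong (λ x → 2 + x) (+-comm 4 k) ⟩
    suc (suc k + 4)   ≤⟨ s≤s (+-monoˡ-≤ 4 k<q∸4) ⟩
    suc (q ∸ 4 + 4)   ≡⟨ cong suc (m∸n+n≡m 4≤q) ⟩
    suc q             ≡⟨ g+k≡1+q ⟨
    g + k             ∎)
    where open ≤-Reasoning

  gap+k : ∀ u v → 6 + u + (5 + v) ≡ suc (10 + u + v)
  gap+k = solve-∀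

counting-bounds-inconsistent : ∀ {q k g a L} → 23 ≤ q → 4 < k → k < q ∸ 4 → g + k ≡ suc q →
  k + a + L ≤ 4 * q ∸ 4 → k + a ≤ L → 2 * q * g ≤ a * g + (2 * L + 2 + a) → ⊥
counting-bounds-inconsistent {q} {k} {g} {a} {L} 23≤q 4<k k<q∸4 g+k≡1+q total≤ k+a≤L main≤
  with v , refl ← m≤n⇒∃[o]m+o≡n 4<k
  with u , refl ← m≤n⇒∃[o]m+o≡n (6≤gap {q} {k} {g} (≤-trans (m≤m+n 4 19) 23≤q) k<q∸4 g+k≡1+q)
  with refl ← suc-injective (trans (sym g+k≡1+q) (gap+k u v))
  = shifted u v a L (+-cancelˡ-≤ 10 13 (u + v) (subst (23 ≤_) (+-assoc 10 u v) 23≤q)) k+a≤L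
      (≤-trans (+-monoˡ-≤ 4 total≤) (≤-reflexive (m∸n+n≡m (*-monoʳ-≤ 4 (≤-trans (s≤s z≤n) 23≤q)))))
      main≤

module PointSet {q : ℕ} (Π : ProjectivePlane q) (PS : Subset (numPts q)) where

  onPS? : ∀ m p → Dec (Incident Π p m × p ∈ PS)
  onPS? m p = incident? Π p m ×-dec p ∈? PS

  pointsOn≡count : ∀ m → pointsOn Π PS m ≡ count (onPS? m)
  pointsOn≡count m = length-filter-allFin (onPS? m)

  missed-by-empty-line : ∀ {m p} → pointsOn Π PS m ≡ 0 → p ∈ PS → inc Π p m ≡ false
  missed-by-empty-line {m} empty p∈PS = ¬-not λ p∈m → contradiction
    (subst (1 ≤_) (trans (sym (pointsOn≡count m)) empty) (1≤count (onPS? m) (p∈m , p∈PS))) λ ()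

  single-point-unique : ∀ {m x y} → pointsOn Π PS m ≡ 1 →
    Incident Π x m × x ∈ PS → Incident Π y m × y ∈ PS → x ≡ y
  single-point-unique {m} one = count≤1⇒unique (onPS? m) (≤-reflexive (trans (sym (pointsOn≡count m)) one))

  module AroundLine (ℓ : Fin (numPts q)) where

    ℓ∖PS? : ∀ R → Dec (Incident Π R ℓ × R ∉ PS)
    ℓ∖PS? R = incident? Π R ℓ ×-dec ¬? (R ∈? PS)

    PS∖ℓ? : ∀ p → Dec (p ∈ PS × ¬ Incident Π p ℓ)
    PS∖ℓ? p = p ∈? PS ×-dec ¬? (incident? Π p ℓ)

    pencil∖ℓ? : ∀ R m → Dec (Incident Π R m × m ≢ ℓ)
    pencil∖ℓ? R m = incident? Π R m ×-dec ¬? (m ≟ ℓ)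

    transversal? : ∀ m → Dec (m ≢ ℓ × ∃ λ R → (Incident Π R ℓ × R ∉ PS) × Incident Π R m)
    transversal? m = ¬? (m ≟ ℓ) ×-dec Fin.any? (λ R → ℓ∖PS? R ×-dec incident? Π R m)

    ℓ∖PS+pointsOn : count ℓ∖PS? + pointsOn Π PS ℓ ≡ suc q
    ℓ∖PS+pointsOn = begin
      count ℓ∖PS? + pointsOn Π PS ℓ    ≡⟨ +-comm _ (pointsOn Π PS ℓ) ⟩
      pointsOn Π PS ℓ + count ℓ∖PS?    ≡⟨ cong (_+ count ℓ∖PS?) (pointsOn≡count ℓ) ⟩
      count (onPS? ℓ) + count ℓ∖PS?    ≡⟨ sumOn-split (λ p → incident? Π p ℓ) (_∈? PS) _ ⟨
      count (λ p → incident? Π p ℓ)    ≡⟨ count-points-on Π ℓ ⟩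
      suc q                            ∎
      where open ≡-Reasoning

    ∣PS∣≡pointsOn+PS∖ℓ : ∣ PS ∣ ≡ pointsOn Π PS ℓ + count PS∖ℓ?
    ∣PS∣≡pointsOn+PS∖ℓ = begin
      ∣ PS ∣                                                  ≡⟨ ∣p∣≡count PS ⟩
      count (_∈? PS)                                          ≡⟨ sumOn-split (_∈? PS) (λ p → incident? Π p ℓ) _ ⟩
      count (λ p → p ∈? PS ×-dec incident? Π p ℓ) + count PS∖ℓ? ≡⟨ cong (_+ count PS∖ℓ?) on-ℓ ⟩
      pointsOn Π PS ℓ + count PS∖ℓ?                           ∎
      where
      open ≡-Reasoning
      on-ℓ : count (λ p → p ∈? PS ×-dec incident? Π p ℓ) ≡ pointsOn Π PS ℓ
      on-ℓ = trans (sumOn-≐ (λ p → p ∈? PS ×-dec incident? Π p ℓ) (onPS? ℓ) _ (swap , swap))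
                   (sym (pointsOn≡count ℓ))

    pencil-points≤ : ∀ {R} → Incident Π R ℓ × R ∉ PS → sumOn (pencil∖ℓ? R) (pointsOn Π PS) ≤ count PS∖ℓ?
    pencil-points≤ {R} (R∈ℓ , R∉PS) = begin
      sumOn (pencil∖ℓ? R) (pointsOn Π PS)            ≡⟨ sumOn-≗ (pencil∖ℓ? R) pointsOn≡count ⟩
      sumOn (pencil∖ℓ? R) (λ m → count (onPS? m))    ≤⟨ double-counting (pencil∖ℓ? R) onPS? PS∖ℓ? _ off-ℓ unique ⟩
      count PS∖ℓ?                                    ∎
      where
      open ≤-Reasoning
      off-ℓ : ∀ {m p} → Incident Π R m × m ≢ ℓ → Incident Π p m × p ∈ PS → p ∈ PS × ¬ Incident Π p ℓ
      off-ℓ (R∈m , m≢ℓ) (p∈m , p∈PS) = p∈PS , λ p∈ℓ →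
        R∉PS (subst (_∈ PS) (lines-meet-once Π m≢ℓ p∈m p∈ℓ R∈m R∈ℓ) p∈PS)
      unique : ∀ {m m′ p} → Incident Π R m × m ≢ ℓ → Incident Π R m′ × m′ ≢ ℓ →
        Incident Π p m × p ∈ PS → Incident Π p m′ × p ∈ PS → m ≡ m′
      unique (R∈m , _) (R∈m′ , _) (p∈m , p∈PS) (p∈m′ , _) =
        points-join-once Π (λ { refl → R∉PS p∈PS }) p∈m R∈m p∈m′ R∈m′

module Resolution {q : ℕ} (Π : ProjectivePlane q) {PS LS : Subset (numPts q)} (resolving : Resolving Π PS LS) where

  open PointSet Π PS

  lines-separated : ∀ {m m′} → m ∉ LS → m′ ∉ LS → (∀ {p} → p ∈ PS → inc Π p m ≡ inc Π p m′) → m ≡ m′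
  lines-separated {m} {m′} m∉LS m′∉LS same = inj₂-injective (resolving (inj₂ m) (inj₂ m′) equidistant)
    where
    equidistant : ∀ s → inS Π PS LS s → dist Π (inj₂ m) s ≡ dist Π (inj₂ m′) s
    equidistant (inj₁ p) p∈PS = begin
      dist Π (inj₂ m) (inj₁ p)       ≡⟨ dist-line-point Π m p ⟩
      (if inc Π p m then 1 else 3)   ≡⟨ cong (if_then 1 else 3) (same p∈PS) ⟩
      (if inc Π p m′ then 1 else 3)  ≡⟨ dist-line-point Π m′ p ⟨
      dist Π (inj₂ m′) (inj₁ p)      ∎
      where open ≡-Reasoning
    equidistant (inj₂ l) l∈LS = trans (dist-line-line Π (λ { refl → m∉LS l∈LS }))
                                      (sym (dist-line-line Π (λ { refl → m′∉LS l∈LS })))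

  empty-lines-separated : ∀ {m m′} → m ∉ LS × pointsOn Π PS m ≡ 0 → m′ ∉ LS × pointsOn Π PS m′ ≡ 0 → m ≡ m′
  empty-lines-separated (m∉LS , empty) (m′∉LS , empty′) =
    lines-separated m∉LS m′∉LS λ p∈PS →
      trans (missed-by-empty-line empty p∈PS) (sym (missed-by-empty-line empty′ p∈PS))

  single-lines-separated : ∀ {m m′ p} → m ∉ LS × pointsOn Π PS m ≡ 1 → m′ ∉ LS × pointsOn Π PS m′ ≡ 1 →
    Incident Π p m × p ∈ PS → Incident Π p m′ × p ∈ PS → m ≡ m′
  single-lines-separated {m} {m′} {p} (m∉LS , one) (m′∉LS , one′) p∈m p∈m′ =
    lines-separated m∉LS m′∉LS λ x∈PS →
      bool-ext (transfer one p∈m p∈m′ x∈PS) (transfer one′ p∈m′ p∈m x∈PS)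
    where
    transfer : ∀ {n n′ x} → pointsOn Π PS n ≡ 1 → Incident Π p n × p ∈ PS → Incident Π p n′ × p ∈ PS →
      x ∈ PS → Incident Π x n → Incident Π x n′
    transfer one p∈n (p∈n′ , _) x∈PS x∈n =
      subst (λ y → Incident Π y _) (sym (single-point-unique one (x∈n , x∈PS) p∈n)) p∈n′

module Deficit {q : ℕ} (Π : ProjectivePlane q) (PS LS : Subset (numPts q)) where

  open PointSet Π PS

  blind? : ∀ m → Dec (m ∉ LS × pointsOn Π PS m ≡ 0)
  blind? m = ¬? (m ∈? LS) ×-dec (pointsOn Π PS m ℕ.≟ 0)

  single? : ∀ m → Dec (m ∉ LS × pointsOn Π PS m ≡ 1)
  single? m = ¬? (m ∈? LS) ×-dec (pointsOn Π PS m ℕ.≟ 1)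

  deficit : Fin (numPts q) → ℕ
  deficit m = if does (m ∈? LS) then 2 else 2 ∸ pointsOn Π PS m

  2≤pointsOn+deficit : ∀ m → 2 ≤ pointsOn Π PS m + deficit m
  2≤pointsOn+deficit m with does (m ∈? LS)
  ... | true  = m≤n+m 2 _
  ... | false = m≤n+m∸n 2 (pointsOn Π PS m)

  module _ (ℓ : Fin (numPts q)) where

    open AroundLine ℓ

    2q≤pencil-deficit : ∀ {R} → Incident Π R ℓ × R ∉ PS → 2 * q ≤ count PS∖ℓ? + sumOn (pencil∖ℓ? R) deficit
    2q≤pencil-deficit {R} R∈ℓ∖PS = begin
      2 * q                                                     ≤⟨ *-monoʳ-≤ 2 (other-lines-through Π R ℓ) ⟩
      2 * count pencil                                          ≡⟨ sumOn-const pencil 2 ⟨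
      sumOn pencil (λ _ → 2)                                    ≤⟨ sumOn-mono pencil (λ {m} _ → 2≤pointsOn+deficit m) ⟩
      sumOn pencil (λ m → pointsOn Π PS m + deficit m)          ≡⟨ sumOn-+ pencil (pointsOn Π PS) deficit ⟩
      sumOn pencil (pointsOn Π PS) + sumOn pencil deficit       ≤⟨ +-monoˡ-≤ _ (pencil-points≤ R∈ℓ∖PS) ⟩
      count PS∖ℓ? + sumOn pencil deficit                        ∎
      where
      open ≤-Reasoning
      pencil : ∀ m → Dec (Incident Π R m × m ≢ ℓ)
      pencil = pencil∖ℓ? R

    gap-pencils≤transversals : sumOn ℓ∖PS? (λ R → sumOn (pencil∖ℓ? R) deficit) ≤ sumOn transversal? deficit
    gap-pencils≤transversals = double-counting ℓ∖PS? pencil∖ℓ? transversal? deficit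
      (λ R∈ℓ∖PS (R∈m , m≢ℓ) → m≢ℓ , _ , R∈ℓ∖PS , R∈m)
      (λ (R∈ℓ , _) (R′∈ℓ , _) (R∈m , m≢ℓ) (R′∈m , _) → lines-meet-once Π m≢ℓ R∈m R∈ℓ R′∈m R′∈ℓ)

    transversal-deficit-split : sumOn transversal? deficit ≤
      sumOn (_∈? LS) (λ _ → 2) + sumOn blind? (λ _ → 2) + count (transversal? ∩? single?)
    transversal-deficit-split = begin
      sumOn transversal? deficit                                       ≤⟨ sum-mono-≤ pointwise ⟩
      ∑[ m < numPts q ] (in-LS m + blind m + single-transversal m)    ≡⟨ ∑-distrib-+ {numPts q} _ single-transversal ⟩
      ∑[ m < numPts q ] (in-LS m + blind m) + count (transversal? ∩? single?)
                                                                       ≡⟨ cong (_+ count (transversal? ∩? single?))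
                                                                               (∑-distrib-+ {numPts q} in-LS blind) ⟩
      sumOn (_∈? LS) (λ _ → 2) + sumOn blind? (λ _ → 2) + count (transversal? ∩? single?) ∎
      where
      open ≤-Reasoning
      in-LS blind single-transversal : Fin (numPts q) → ℕ
      in-LS m = if does (m ∈? LS) then 2 else 0
      blind m = if does (blind? m) then 2 else 0
      single-transversal m = if does ((transversal? ∩? single?) m) then 1 else 0
      cases : ∀ t l k → (if t then (if l then 2 else 2 ∸ k) else 0) ≤
        (if l then 2 else 0) + (if not l ∧ (k ℕ.≡ᵇ 0) then 2 else 0) + (if t ∧ (not l ∧ (k ℕ.≡ᵇ 1)) then 1 else 0)
      cases false _     _             = z≤n
      cases true  true  _             = ≤-refl
      cases true  false zero          = ≤-refl
      cases true  false (suc zero)    = ≤-refl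
      cases true  false (suc (suc k)) = ≤-reflexive (0∸n≡0 k)
      pointwise : ∀ m → (if does (transversal? m) then deficit m else 0) ≤ in-LS m + blind m + single-transversal m
      pointwise m = cases (does (transversal? m)) (does (m ∈? LS)) (pointsOn Π PS m)

    module _ (resolving : Resolving Π PS LS) where

      open Resolution Π resolving

      single-transversals≤PS∖ℓ : count (transversal? ∩? single?) ≤ count PS∖ℓ?
      single-transversals≤PS∖ℓ = count-≤-injective (transversal? ∩? single?) onPS? PS∖ℓ?
        (λ (_ , _ , one) → count-witness (onPS? _) (≤-reflexive (sym (trans (sym (pointsOn≡count _)) one))))
        (λ ((m≢ℓ , R , (R∈ℓ , R∉PS) , R∈m) , _) (p∈m , p∈PS) → p∈PS , λ p∈ℓ →
           R∉PS (subst (_∈ PS) (lines-meet-once Π m≢ℓ p∈m p∈ℓ R∈m R∈ℓ) p∈PS))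
        (λ (_ , single) (_ , single′) → single-lines-separated single single′)

      transversal-deficit≤ : sumOn transversal? deficit ≤ 2 * ∣ LS ∣ + 2 + count PS∖ℓ?
      transversal-deficit≤ = begin
        sumOn transversal? deficit
          ≤⟨ transversal-deficit-split ⟩
        sumOn (_∈? LS) (λ _ → 2) + sumOn blind? (λ _ → 2) + count (transversal? ∩? single?)
          ≡⟨ cong₂ (λ x y → x + y + count (transversal? ∩? single?))
                   (sumOn-const (_∈? LS) 2) (sumOn-const blind? 2) ⟩
        2 * count (_∈? LS) + 2 * count blind? + count (transversal? ∩? single?)
          ≤⟨ +-mono-≤ (+-mono-≤ (≤-reflexive (cong (2 *_) (sym (∣p∣≡count LS))))
                                (*-monoʳ-≤ 2 (count≤1 blind? empty-lines-separated)))
                      single-transversals≤PS∖ℓ ⟩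
        2 * ∣ LS ∣ + 2 + count PS∖ℓ?
          ∎
        where open ≤-Reasoning

      main-inequality : 2 * q * count ℓ∖PS? ≤ count PS∖ℓ? * count ℓ∖PS? + (2 * ∣ LS ∣ + 2 + count PS∖ℓ?)
      main-inequality = begin
        2 * q * count ℓ∖PS?                                            ≡⟨ sumOn-const ℓ∖PS? (2 * q) ⟨
        sumOn ℓ∖PS? (λ _ → 2 * q)                                      ≤⟨ sumOn-mono ℓ∖PS? 2q≤pencil-deficit ⟩
        sumOn ℓ∖PS? (λ R → count PS∖ℓ? + sumOn (pencil∖ℓ? R) deficit)  ≡⟨ sumOn-+ ℓ∖PS? _ _ ⟩
        sumOn ℓ∖PS? (λ _ → count PS∖ℓ?) + sumOn ℓ∖PS? (λ R → sumOn (pencil∖ℓ? R) deficit)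
          ≤⟨ +-mono-≤ (≤-reflexive (sumOn-const ℓ∖PS? (count PS∖ℓ?)))
                      (≤-trans gap-pencils≤transversals transversal-deficit≤) ⟩
        count PS∖ℓ? * count ℓ∖PS? + (2 * ∣ LS ∣ + 2 + count PS∖ℓ?)    ∎
        where open ≤-Reasoning

proposition2p5 : (q : ℕ) → 23 ≤ q → (Π : ProjectivePlane q) →
    (PS LS : Subset (numPts q)) → Resolving Π PS LS →
    ∣ PS ∣ + ∣ LS ∣ ≤ 4 * q ∸ 4 → ∣ PS ∣ ≤ ∣ LS ∣ →
    ∀ ℓ → pointsOn Π PS ℓ ≤ 4 ⊎ q ∸ 4 ≤ pointsOn Π PS ℓ
proposition2p5 q 23≤q Π PS LS resolving size≤ PS≤LS ℓ
  with pointsOn Π PS ℓ ≤? 4 | q ∸ 4 ≤? pointsOn Π PS ℓ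
... | yes few | _        = inj₁ few
... | no  _   | yes many = inj₂ many
... | no ¬few | no ¬many = ⊥-elim (counting-bounds-inconsistent 23≤q (≰⇒> ¬few) (≰⇒> ¬many)
      ℓ∖PS+pointsOn
      (subst (λ s → s + ∣ LS ∣ ≤ 4 * q ∸ 4) ∣PS∣≡pointsOn+PS∖ℓ size≤)
      (subst (_≤ ∣ LS ∣) ∣PS∣≡pointsOn+PS∖ℓ PS≤LS)
      (main-inequality ℓ resolving))
  where
  open PointSet Π PS
  open AroundLine ℓ
  open Deficit Π PS LS
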